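{- Let $p$ and $q$ be two distinct prime numbers and $d\ge1$ an integer. Then $|\mathcal{P}_{d,p}\cup\mathcal{P}_{d,q}|=p+q-1$.
   Context: For a real $x\ge0$, $\{x\}$ denotes its fractional part. For a prime $p$, the $p$-set is $\mathcal{P}_{d,p}=\{\mathbf{x}_0,\ldots,\mathbf{x}_{p-1}\}\subset[0,1)^d$ with $\mathbf{x}_j=(\{j/p\},\{j^2/p\},\ldots,\{j^d/p\})$ for $j=0,1,\ldots,p-1$. -}

module Defs where

open import Data.Nat using (ℕ; suc; _^_; NonZero)
open import Data.Nat.Primality using (Prime; prime⇒nonZero)
open import Data.Integer using (+_)
open import Data.Rational using (ℚ; _/_; fracPart)
open import Data.Rational.Properties using (_≟_)
open import Data.Fin using (Fin; toℕ)
open import Data.Vec using (Vec; tabulate)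
open import Data.Vec.Properties using (≡-dec)
open import Data.List using (List; upTo; map; length; deduplicate; _++_)

-- The point x_j = ({j/p}, {j^2/p}, ..., {j^d/p}) ∈ [0,1)^d (rational coordinates).
-- Coordinate index i : Fin d corresponds to the exponent k = i + 1.
point : (d p : ℕ) → .{{NonZero p}} → ℕ → Vec ℚ d
point d p j = tabulate λ (i : Fin d) → fracPart ((+ (j ^ suc (toℕ i))) / p)

pSet : (d p : ℕ) → Prime p → List (Vec ℚ d)
pSet d p pr = map (λ j → point d p {{prime⇒nonZero pr}} j) (upTo p)

card : ∀ {d} → List (Vec ℚ d) → ℕ
card xs = length (deduplicate (≡-dec _≟_) xs)

cardUnion : ∀ {d} → List (Vec ℚ d) → List (Vec ℚ d) → ℕ
cardUnion xs ys = card (xs ++ ys)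

module Submission where

-- The first coordinate of x_j ∈ P_{d,p} is {j/p} = j/p for 0 ≤ j < p.  Hence
--   * the p points of P_{d,p} are pairwise distinct (distinct first coordinates),
--   * x_0 = 0 belongs to both P_{d,p} and P_{d,q},
--   * a further common point x_i = y_j with 0 < i < p, j < q would give i/p = j/q,
--     i.e. i q = j p; then p ∣ i q, so p ∣ i (p, q distinct primes), impossible.
-- Thus the two sets are enumerations of p and q distinct points meeting only in the
-- origin, and their union has p + q - 1 elements.

open import Data.Nat as ℕ
  using (ℕ; zero; suc; _+_; _*_; _∸_; _<_; _≥_; s≤s; z≤n; NonZero; >-nonZero; >-nonZero⁻¹)
open import Data.Nat.Properties using (+-suc; *-identityʳ; *-cancelʳ-≡; *-cancelʳ-<; <⇒≢; <⇒≱; ≤-trans; <-trans)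
open import Data.Nat.DivMod using (m<n⇒m/n≡0; m/n*n≡m)
open import Data.Nat.Divisibility using (divides; ∣⇒≤)
open import Data.Nat.GCD using (gcd; gcd[m,n]∣m; gcd[m,n]∣n; gcd[m,n]≢0)
open import Data.Nat.Coprimality using (Coprime)
open import Data.Nat.Primality using (Prime; euclidsLemma; prime⇒irreducible; ¬prime[0]; ¬prime[1])
open import Data.Integer as ℤ using (+_; 0ℤ)
open import Data.Rational using (mkℚ; mkℚ+; 0ℚ; fracPart; truncate; ∣_∣; _/_; _-_)
open import Data.Rational.Properties using (_≟_; +-identityʳ; 0/n≡0; normalize-injective-≃)
open import Data.Vec using (head; tabulate)
open import Data.Vec.Properties using (≡-dec; tabulate-cong)
open import Data.List using ([]; _∷_; _++_; map; length; upTo; applyUpTo; filter; deduplicate)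
open import Data.List.Properties using (length-++; length-applyUpTo; filter-++; filter-all; filter-reject; map-applyUpTo)
open import Data.List.Relation.Unary.All as All using (All)
open import Data.List.Relation.Unary.AllPairs using ([]; _∷_)
open import Data.List.Relation.Unary.Unique.Propositional using (Unique)
import Data.List.Relation.Unary.Unique.Propositional.Properties as Unique
open import Data.List.Relation.Binary.Disjoint.Propositional using (Disjoint)
open import Data.List.Membership.Propositional.Properties using (∈-applyUpTo⁻)
open import Data.List.Relation.Unary.Any using (here; there)
open import Data.Product using (_,_)
open import Data.Sum using (inj₁; inj₂)
open import Data.Empty using (⊥-elim)
open import Relation.Binary.Definitions using (DecidableEquality)
open import Relation.Binary.PropositionalEquality
open import Relation.Nullary using (¬?)
open import Function using (_∘_)

open import Defs

truncate-proper : ∀ a m .(c : Coprime a (suc m)) → a < suc m → truncate (mkℚ (+ a) m c) ≡ 0ℤ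
truncate-proper zero    m c _   = refl
truncate-proper (suc a) m c a<n = cong (λ k → + 1 ℤ.* + k) (m<n⇒m/n≡0 a<n)

fracPart-proper : ∀ a m .(c : Coprime a (suc m)) → a < suc m → fracPart (mkℚ (+ a) m c) ≡ mkℚ (+ a) m c
fracPart-proper a m c a<n = begin
  ∣ r - truncate r / 1 ∣ ≡⟨ cong (λ t → ∣ r - t / 1 ∣) (truncate-proper a m c a<n) ⟩
  ∣ r - 0ℤ / 1 ∣         ≡⟨ cong (λ t → ∣ r - t ∣) (0/n≡0 1) ⟩
  ∣ r - 0ℚ ∣             ≡⟨ cong ∣_∣ (+-identityʳ r) ⟩
  r                      ∎
  where
  open ≡-Reasoning
  r = mkℚ (+ a) m c

-- For j < n the rational j/n is its own fractional part: {j/n} = j/n.  Its normal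
-- form is (j/g)/(n/g) with g = gcd j n, and j/g < n/g.
fracPart-j/n : ∀ j n .{{_ : NonZero n}} → j < n → fracPart (+ j / n) ≡ + j / n
fracPart-j/n j n j<n = reduced (j ℕ./ g) (n ℕ./ g) {{n/g≢0}} _ j/g<n/g
  where
  g = gcd j n
  instance
    g≢0 : NonZero g
    g≢0 = ℕ.≢-nonZero (gcd[m,n]≢0 j n (inj₂ (ℕ.≢-nonZero⁻¹ n)))
  j/g<n/g : j ℕ./ g < n ℕ./ g
  j/g<n/g = *-cancelʳ-< g (j ℕ./ g) (n ℕ./ g)
    (subst₂ _<_ (sym (m/n*n≡m (gcd[m,n]∣m j n))) (sym (m/n*n≡m (gcd[m,n]∣n j n))) j<n)
  n/g≢0 : NonZero (n ℕ./ g)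
  n/g≢0 = >-nonZero (≤-trans (s≤s z≤n) j/g<n/g)
  reduced : ∀ a b .{{_ : NonZero b}} .(c : Coprime a b) → a < b → fracPart (mkℚ+ a b c) ≡ mkℚ+ a b c
  reduced a (suc m) c a<b = fracPart-proper a m c a<b

point-head : ∀ d n .{{_ : NonZero n}} j → j < n → head (point (suc d) n j) ≡ + j / n
point-head d n j j<n =
  trans (cong (λ k → fracPart (+ k / n)) (*-identityʳ j)) (fracPart-j/n j n j<n)

point-origin : ∀ d n .{{_ : NonZero n}} → point d n 0 ≡ tabulate (λ _ → 0ℚ)
point-origin d n = tabulate-cong λ _ → trans (fracPart-j/n 0 n (>-nonZero⁻¹ n)) (0/n≡0 n)

-- Equal points x_i (modulus m) and y_j (modulus n) with i < m, j < n have equal first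
-- coordinates i/m = j/n, i.e. i n = j m.
point-cross : ∀ d m n {{_ : NonZero m}} {{_ : NonZero n}} {i j} → i < m → j < n →
  point (suc d) m i ≡ point (suc d) n j → i * n ≡ j * m
point-cross d m n {i} {j} i<m j<n e = normalize-injective-≃ i j m n (begin
  + i / m                  ≡⟨ point-head d m i i<m ⟨
  head (point (suc d) m i) ≡⟨ cong head e ⟩
  head (point (suc d) n j) ≡⟨ point-head d n j j<n ⟩
  + j / n                  ∎)
  where open ≡-Reasoning

point-injective : ∀ d n {{_ : NonZero n}} {i j} → i < j → j < n → point (suc d) n i ≢ point (suc d) n j
point-injective d n {i} {j} i<j j<n e =
  <⇒≢ i<j (*-cancelʳ-≡ i j n (point-cross d n n (<-trans i<j j<n) j<n e))

-- For distinct primes p, q the equation i q = j p has no solution with 0 < i < p: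
-- p ∣ i q forces p ∣ i (as p ∤ q), contradicting 0 < i < p.
distinct-primes-cross : ∀ {p q i j} → Prime p → Prime q → p ≢ q → 0 < i → i < p → i * q ≢ j * p
distinct-primes-cross {p} {q} {i} {j} pp pq p≢q 0<i i<p e with euclidsLemma i q pp (divides j e)
... | inj₁ p∣i = <⇒≱ i<p (∣⇒≤ {{>-nonZero 0<i}} p∣i)
... | inj₂ p∣q with prime⇒irreducible pq p∣q
...   | inj₁ p≡1 = ¬prime[1] (subst Prime p≡1 pp)
...   | inj₂ p≡q = p≢q p≡q

module Counting {V : Set} (_≟ᵥ_ : DecidableEquality V) where

  deduplicate-unique : ∀ {xs} → Unique xs → deduplicate _≟ᵥ_ xs ≡ xs
  deduplicate-unique {[]}     []          = refl
  deduplicate-unique {x ∷ xs} (x∉xs ∷ uxs) =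
    cong (x ∷_) (trans (cong (filter (¬? ∘ (x ≟ᵥ_))) (deduplicate-unique uxs)) (filter-all (¬? ∘ (x ≟ᵥ_)) x∉xs))

  length-union-shared-head : ∀ {x xs ys} → Unique (x ∷ xs) → Unique (x ∷ ys) → Disjoint xs ys →
    length (deduplicate _≟ᵥ_ ((x ∷ xs) ++ (x ∷ ys))) ≡ suc (length xs + length ys)
  length-union-shared-head {x} {xs} {ys} (x∉xs ∷ uxs) uxys@(x∉ys ∷ _) xs#ys = begin
    suc (length (filter ≢x? (deduplicate _≟ᵥ_ (xs ++ x ∷ ys))))
      ≡⟨ cong (suc ∘ length ∘ filter ≢x?) (deduplicate-unique (Unique.++⁺ uxs uxys xs#xys)) ⟩
    suc (length (filter ≢x? (xs ++ x ∷ ys)))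
      ≡⟨ cong (suc ∘ length) (filter-++ ≢x? xs (x ∷ ys)) ⟩
    suc (length (filter ≢x? xs ++ filter ≢x? (x ∷ ys)))
      ≡⟨ cong₂ (λ as bs → suc (length (as ++ bs))) (filter-all ≢x? x∉xs)
               (trans (filter-reject ≢x? (λ x≢x → x≢x refl)) (filter-all ≢x? x∉ys)) ⟩
    suc (length (xs ++ ys))
      ≡⟨ cong suc (length-++ xs) ⟩
    suc (length xs + length ys) ∎
    where
    open ≡-Reasoning
    ≢x? = ¬? ∘ (x ≟ᵥ_)
    xs#xys : Disjoint xs (x ∷ ys)
    xs#xys (v∈xs , here refl)  = All.lookup x∉xs v∈xs refl
    xs#xys (v∈xs , there v∈ys) = xs#ys (v∈xs , v∈ys)

  length-union-enumerations : (F G : ℕ → V) (m n : ℕ) → F 0 ≡ G 0 →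
    (∀ {i j} → i < j → j < suc m → F i ≢ F j) →
    (∀ {i j} → i < j → j < suc n → G i ≢ G j) →
    (∀ {i j} → i < m → j < n → F (suc i) ≢ G (suc j)) →
    length (deduplicate _≟ᵥ_ (map F (upTo (suc m)) ++ map G (upTo (suc n)))) ≡ suc m + suc n ∸ 1
  length-union-enumerations F G m n F0≡G0 F-inj G-inj F≢G = begin
    length (deduplicate _≟ᵥ_ ((F 0 ∷ map F (applyUpTo suc m)) ++ (G 0 ∷ map G (applyUpTo suc n))))
      ≡⟨ cong₂ (λ as bs → length (deduplicate _≟ᵥ_ ((F 0 ∷ as) ++ bs)))
               (map-applyUpTo suc F m) (cong (_∷ _) (sym F0≡G0)) ⟩
    length (deduplicate _≟ᵥ_ ((F 0 ∷ xs) ++ (F 0 ∷ map G (applyUpTo suc n))))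
      ≡⟨ cong (λ bs → length (deduplicate _≟ᵥ_ ((F 0 ∷ xs) ++ (F 0 ∷ bs)))) (map-applyUpTo suc G n) ⟩
    length (deduplicate _≟ᵥ_ ((F 0 ∷ xs) ++ (F 0 ∷ ys)))
      ≡⟨ length-union-shared-head (Unique.applyUpTo⁺₁ F (suc m) F-inj)
           (subst (λ y → Unique (y ∷ ys)) (sym F0≡G0) (Unique.applyUpTo⁺₁ G (suc n) G-inj)) xs#ys ⟩
    suc (length xs + length ys)
      ≡⟨ cong₂ (λ a b → suc (a + b)) (length-applyUpTo (F ∘ suc) m) (length-applyUpTo (G ∘ suc) n) ⟩
    suc (m + n)
      ≡⟨ +-suc m n ⟨
    suc m + suc n ∸ 1 ∎
    where
    open ≡-Reasoning
    xs = applyUpTo (F ∘ suc) m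
    ys = applyUpTo (G ∘ suc) n
    xs#ys : Disjoint xs ys
    xs#ys (v∈xs , v∈ys) with ∈-applyUpTo⁻ (F ∘ suc) v∈xs | ∈-applyUpTo⁻ (G ∘ suc) v∈ys
    ... | i , i<m , refl | j , j<n , e = F≢G i<m j<n e

theorem2p3 : (p q d : ℕ) → (pp : Prime p) → (pq : Prime q) → p ≢ q → d ≥ 1 →
    cardUnion (pSet d p pp) (pSet d q pq) ≡ p + q ∸ 1
theorem2p3 zero    _       _       pp _  _   _ = ⊥-elim (¬prime[0] pp)
theorem2p3 (suc _) zero    _       _  pq _   _ = ⊥-elim (¬prime[0] pq)
theorem2p3 (suc m) (suc n) (suc d) pp pq p≢q _ =
  length-union-enumerations (point (suc d) (suc m)) (point (suc d) (suc n)) m n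
    (trans (point-origin (suc d) (suc m)) (sym (point-origin (suc d) (suc n))))
    (point-injective d (suc m))
    (point-injective d (suc n))
    (λ {i} {j} i<m j<n e → distinct-primes-cross {j = suc j} pp pq p≢q (s≤s z≤n) (s≤s i<m)
                             (point-cross d (suc m) (suc n) (s≤s i<m) (s≤s j<n) e))
  where open Counting (≡-dec _≟_)
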